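{- Let $\mathcal{S}$ be a partial geometry $PG(s,t,\alpha)$ with $s,t>1$ and $\alpha>(t+1)/2$, and let $X$ be its point graph. Suppose that every $(s+1)$-clique of $X$ is (the point set of) a line of $\mathcal{S}$. Then every proper endomorphism of $X$ has a single $(s+1)$-clique as its image, and is therefore a colouring of $X$ (a homomorphism onto $K_{s+1}$).
   Context: A partial geometry $PG(s,t,\alpha)$ is a point-line incidence structure such that: (1) two distinct lines meet in at most one point and two distinct points lie on at most one common line; (2) each line contains $s+1$ points and each point lies on $t+1$ lines; (3) for any point $P$ and line $\ell$ not containing $P$, there are exactly $\alpha$ lines through $P$ meeting $\ell$. Its point graph has the points as vertices, two distinct points adjacent iff they are collinear. A homomorphism $X\to Y$ is a map $V(X)\to V(Y)$ sending edges to edges; an endomorphism of $X$ is a homomorphism $X\to X$; a proper endomorphism is an endomorphism that is not an automorphism. -}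

module Defs where

open import Data.Nat using (ℕ; zero; suc; _+_)
open import Data.Bool using (Bool; true; false; if_then_else_; _∧_; _∨_)
open import Data.Fin using (Fin; zero; suc)
open import Data.Product using (Σ; _×_; _,_; ∃)
open import Relation.Binary.PropositionalEquality using (_≡_; _≢_)
open import Relation.Nullary using (¬_)
open import Function using (_∘_)
open import Function.Bundles using (_⇔_)

count : {n : ℕ} → (Fin n → Bool) → ℕ
count {zero} f = 0
count {suc n} f = (if f zero then 1 else 0) + count (f ∘ suc)

anyB : {n : ℕ} → (Fin n → Bool) → Bool
anyB {zero} f = false
anyB {suc n} f = f zero ∨ anyB (f ∘ suc)

record IsPartialGeometry (n m s t α : ℕ) (inc : Fin n → Fin m → Bool) : Set where
  field
    lines-meet-once : ∀ (l l' : Fin m) (p q : Fin n) → l ≢ l' →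
                      inc p l ≡ true → inc p l' ≡ true →
                      inc q l ≡ true → inc q l' ≡ true → p ≡ q
    points-joined-once : ∀ (p q : Fin n) (l l' : Fin m) → p ≢ q →
                      inc p l ≡ true → inc q l ≡ true →
                      inc p l' ≡ true → inc q l' ≡ true → l ≡ l'
    line-size   : ∀ (l : Fin m) → count (λ p → inc p l) ≡ suc s
    point-degree : ∀ (p : Fin n) → count (λ l → inc p l) ≡ suc t
    alpha-axiom : ∀ (p : Fin n) (l : Fin m) → inc p l ≡ false →
                  count (λ l' → inc p l' ∧ anyB (λ q → inc q l' ∧ inc q l)) ≡ α

Adj : {n m : ℕ} → (Fin n → Fin m → Bool) → Fin n → Fin n → Set
Adj {n} {m} inc p q = p ≢ q × ∃ λ (l : Fin m) → inc p l ≡ true × inc q l ≡ true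

IsEndomorphism : {n : ℕ} → (Fin n → Fin n → Set) → (Fin n → Fin n) → Set
IsEndomorphism {n} E f = ∀ (p q : Fin n) → E p q → E (f p) (f q)

IsAutomorphism : {n : ℕ} → (Fin n → Fin n → Set) → (Fin n → Fin n) → Set
IsAutomorphism {n} E f =
  (∀ (x y : Fin n) → f x ≡ f y → x ≡ y) ×
  (∀ (y : Fin n) → ∃ λ x → f x ≡ y) ×
  (∀ (p q : Fin n) → E p q ⇔ E (f p) (f q))

IsProperEndomorphism : {n : ℕ} → (Fin n → Fin n → Set) → (Fin n → Fin n) → Set
IsProperEndomorphism E f = IsEndomorphism E f × ¬ IsAutomorphism E f

IsClique : {n : ℕ} → (Fin n → Fin n → Set) → ℕ → (Fin n → Bool) → Set
IsClique {n} E k C =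
  count C ≡ k × (∀ (p q : Fin n) → C p ≡ true → C q ≡ true → p ≢ q → E p q)

IsImage : {n : ℕ} → (Fin n → Fin n) → (Fin n → Bool) → Set
IsImage {n} f C = ∀ (q : Fin n) → (C q ≡ true) ⇔ (∃ λ p → f p ≡ q)

IsHomToComplete : {n k : ℕ} → (Fin n → Fin n → Set) → (Fin n → Fin k) → Set
IsHomToComplete {n} E c = ∀ (p q : Fin n) → E p q → c p ≢ c q

IsSurjective : {n k : ℕ} → (Fin n → Fin k) → Set
IsSurjective {n} {k} c = ∀ (y : Fin k) → ∃ λ x → c x ≡ y

module Submission where

-- An endomorphism f maps adjacent points to distinct points, so it is
-- injective on each line ℓ and maps it onto an (s+1)-clique, i.e. onto a line
-- lineImage ℓ.  If f is injective it is a permutation of the points inducing a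
-- permutation of the lines, hence an automorphism.  Otherwise f identifies
-- two points x ≠ y.  Counting the α lines through y that meet each of two
-- lines through x shows (since 2α > t + 1) that all lines through x have one
-- common image line; using a second line through x, every neighbour of x is
-- identified with some other point too, and via a transversal (α > 0) every
-- point is mapped onto that line.  So the image of f is exactly a line, which
-- is an (s+1)-clique, and enumerating its points turns f into a colouring.

open import Defs
open import Data.Nat using (ℕ; zero; suc; _+_; _*_; _<_; _≤_; z≤n; s≤s)
open import Data.Nat.Properties
  using (+-identityʳ; +-mono-≤; +-suc; <⇒≤; <⇒≱; <-irrefl; ≤-refl; +-commutativeSemigroup; module ≤-Reasoning)
open import Data.Bool using (Bool; true; false; if_then_else_; _∧_; _∨_)
import Data.Bool.Properties as B
open import Data.Fin using (Fin; zero; suc; punchOut; _≟_)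
open import Data.Fin.Properties using (suc-injective; punchOut-injective; injective⇒≤; any?)
open import Data.Product using (_×_; _,_; ∃; proj₁; proj₂)
open import Data.Empty using (⊥; ⊥-elim; ⊥-elim-irr)
open import Relation.Binary.PropositionalEquality
open import Relation.Nullary using (¬_; Dec; yes; no; does; ¬?; _×-dec_)
open import Relation.Nullary.Decidable using (dec-true)
open import Function using (_∘_)
open import Function.Bundles using (_⇔_; mk⇔; Equivalence)
open import Algebra.Properties.CommutativeSemigroup +-commutativeSemigroup using (interchange)

private
  variable
    n k : ℕ

_⊆_ : (Fin n → Bool) → (Fin n → Bool) → Set
A ⊆ B = ∀ v → A v ≡ true → B v ≡ true

true≢false : true ≢ false
true≢false ()

∧-split : {a b : Bool} → (a ∧ b) ≡ true → a ≡ true × b ≡ true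
∧-split {true} {true} _ = refl , refl

does-sound : {A : Set} (a? : Dec A) → does a? ≡ true → A
does-sound (yes a) _ = a

count-witness : (h : Fin n → Bool) → 0 < count h → ∃ λ a → h a ≡ true
count-witness {suc n} h pos with h zero in eq
... | true  = zero , eq
... | false = let a , ha = count-witness (h ∘ suc) pos in suc a , ha

count-other-witness : (h : Fin n → Bool) → 1 < count h → ∀ c → ∃ λ a → a ≢ c × h a ≡ true
count-other-witness {suc n} h two c with h zero in eq
count-other-witness {suc n} h (s≤s pos) zero | true =
  let a , ha = count-witness (h ∘ suc) pos in suc a , (λ ()) , ha
count-other-witness {suc n} h two (suc c) | true = zero , (λ ()) , eq
count-other-witness {suc n} h two zero | false =
  let a , ha = count-witness (h ∘ suc) (<⇒≤ two) in suc a , (λ ()) , ha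
count-other-witness {suc n} h two (suc c) | false =
  let a , a≢c , ha = count-other-witness (h ∘ suc) two c in suc a , a≢c ∘ suc-injective , ha

anyB-witness : (h : Fin n → Bool) → anyB h ≡ true → ∃ λ a → h a ≡ true
anyB-witness {suc n} h any with h zero in eq
... | true  = zero , eq
... | false = let a , ha = anyB-witness (h ∘ suc) any in suc a , ha

anyB-intro : (h : Fin n → Bool) (a : Fin n) → h a ≡ true → anyB h ≡ true
anyB-intro {suc n} h zero ha rewrite ha = refl
anyB-intro {suc n} h (suc a) ha with h zero
... | true  = refl
... | false = anyB-intro (h ∘ suc) a ha

disjoint-count : (A B D : Fin n → Bool) → A ⊆ D → B ⊆ D →
                 (∀ v → A v ≡ true → B v ≡ true → ⊥) → count A + count B ≤ count D
disjoint-count {zero} A B D A⊆D B⊆D disjoint = z≤n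
disjoint-count {suc n} A B D A⊆D B⊆D disjoint = begin
  (iA + cA) + (iB + cB)  ≡⟨ interchange iA cA iB cB ⟩
  (iA + iB) + (cA + cB)  ≤⟨ +-mono-≤ (indicators (A zero) (B zero) (D zero)
                                        (A⊆D zero) (B⊆D zero) (disjoint zero))
                                     (disjoint-count (A ∘ suc) (B ∘ suc) (D ∘ suc)
                                        (A⊆D ∘ suc) (B⊆D ∘ suc) (disjoint ∘ suc)) ⟩
  iD + cD                ∎
  where
  open ≤-Reasoning
  indicator : Bool → ℕ
  indicator b = if b then 1 else 0
  iA = indicator (A zero)
  iB = indicator (B zero)
  iD = indicator (D zero)
  cA = count (A ∘ suc)
  cB = count (B ∘ suc)
  cD = count (D ∘ suc)
  indicators : ∀ a b d → (a ≡ true → d ≡ true) → (b ≡ true → d ≡ true) →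
               (a ≡ true → b ≡ true → ⊥) → indicator a + indicator b ≤ indicator d
  indicators true  true  d a⇒d b⇒d a∩b = ⊥-elim (a∩b refl refl)
  indicators true  false d a⇒d b⇒d a∩b rewrite a⇒d refl = ≤-refl
  indicators false true  d a⇒d b⇒d a∩b rewrite b⇒d refl = ≤-refl
  indicators false false d a⇒d b⇒d a∩b = z≤n

common-element : (A B D : Fin n → Bool) → A ⊆ D → B ⊆ D → count D < count A + count B →
                 ∃ λ v → A v ≡ true × B v ≡ true
common-element A B D A⊆D B⊆D large with any? (λ v → (A v B.≟ true) ×-dec (B v B.≟ true))
... | yes meet = meet
... | no  apart = ⊥-elim (<⇒≱ large (disjoint-count A B D A⊆D B⊆D λ v a b → apart (v , a , b)))

count-false : count {n} (λ _ → false) ≡ 0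
count-false {zero}  = refl
count-false {suc n} = count-false {n}

count-insert : (h : Fin n → Bool) (a : Fin n) → h a ≡ false →
               count (λ v → does (a ≟ v) ∨ h v) ≡ suc (count h)
count-insert {suc n} h zero    ha rewrite ha = refl
count-insert {suc n} h (suc a) ha =
  trans (cong ((if h zero then 1 else 0) +_) (count-insert (h ∘ suc) a ha)) (+-suc _ _)

image : (S : Fin n → Bool) (g : Fin n → Fin k) → Fin k → Bool
image S g v = anyB (λ u → S u ∧ does (g u ≟ v))

image-intro : (S : Fin n → Bool) (g : Fin n → Fin k) (u : Fin n) → S u ≡ true →
              image S g (g u) ≡ true
image-intro S g u Su = anyB-intro _ u (cong₂ _∧_ Su (dec-true (g u ≟ g u) refl))

image-elim : (S : Fin n → Bool) (g : Fin n → Fin k) (v : Fin k) → image S g v ≡ true →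
             ∃ λ u → S u ≡ true × g u ≡ v
image-elim S g v img =
  let u , hit = anyB-witness _ img
      Su , gu≡v = ∧-split hit
  in u , Su , does-sound (g u ≟ v) gu≡v

image-count : (S : Fin n → Bool) (g : Fin n → Fin k) →
              (∀ u u' → S u ≡ true → S u' ≡ true → g u ≡ g u' → u ≡ u') →
              count (image S g) ≡ count S
image-count {zero} {k} S g injective = count-false {k}
image-count {suc n} S g injective with S zero in S0
... | false = image-count (S ∘ suc) (g ∘ suc) injective-tail
  where
  injective-tail : ∀ u u' → S (suc u) ≡ true → S (suc u') ≡ true → g (suc u) ≡ g (suc u') → u ≡ u'
  injective-tail u u' Su Su' e = suc-injective (injective (suc u) (suc u') Su Su' e)
... | true = trans (count-insert (image (S ∘ suc) (g ∘ suc)) (g zero) new)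
                   (cong suc (image-count (S ∘ suc) (g ∘ suc) injective-tail))
  where
  injective-tail : ∀ u u' → S (suc u) ≡ true → S (suc u') ≡ true → g (suc u) ≡ g (suc u') → u ≡ u'
  injective-tail u u' Su Su' e = suc-injective (injective (suc u) (suc u') Su Su' e)
  -- g zero is not already hit by the rest of S, as g is injective on S.
  new : image (S ∘ suc) (g ∘ suc) (g zero) ≡ false
  new with image (S ∘ suc) (g ∘ suc) (g zero) in hit
  ... | false = refl
  ... | true with image-elim (S ∘ suc) (g ∘ suc) (g zero) hit
  ... | u , Su , gu≡g0 with () ← injective (suc u) zero Su S0 gu≡g0

-- A bijection between Fin k and the elements of a subset h of Fin n.  The
-- membership proof passed to `index` is irrelevant, so `index` depends on the
-- element only.
record Enumeration (h : Fin n → Bool) (k : ℕ) : Set where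
  field
    element       : Fin k → Fin n
    index         : (v : Fin n) → .(h v ≡ true) → Fin k
    element-in    : ∀ i → h (element i) ≡ true
    element-index : ∀ v .(hv : h v ≡ true) → element (index v hv) ≡ v
    index-element : ∀ i .(hi : h (element i) ≡ true) → index (element i) hi ≡ i

enumerate : (h : Fin n → Bool) → Enumeration h (count h)
enumerate {zero} h = record
  { element = λ () ; index = λ () ; element-in = λ () ; element-index = λ () ; index-element = λ () }
enumerate {suc n} h with h zero in h0 | enumerate (h ∘ suc)
... | true | E = record
  { element = λ { zero → zero ; (suc i) → suc (element i) }
  ; index = λ { zero _ → zero ; (suc v) hv → suc (index v hv) }
  ; element-in = λ { zero → h0 ; (suc i) → element-in i }
  ; element-index = λ { zero _ → refl ; (suc v) hv → cong suc (element-index v hv) }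
  ; index-element = λ { zero _ → refl ; (suc i) hi → cong suc (index-element i hi) }
  }
  where open Enumeration E
... | false | E = record
  { element = suc ∘ element
  ; index = λ { zero h0' → ⊥-elim-irr (true≢false (trans (sym h0') h0)) ; (suc v) hv → index v hv }
  ; element-in = element-in
  ; element-index = λ { zero h0' → ⊥-elim-irr (true≢false (trans (sym h0') h0))
                      ; (suc v) hv → cong suc (element-index v hv) }
  ; index-element = index-element
  }
  where open Enumeration E

enumerate-sized : (h : Fin n → Bool) → count h ≡ k → Enumeration h k
enumerate-sized h refl = enumerate h

injective⇒surjective : (g : Fin n → Fin n) → (∀ x y → g x ≡ g y → x ≡ y) → ∀ y → ∃ λ x → g x ≡ y
injective⇒surjective {suc n} g injective y with any? (λ x → g x ≟ y)
... | yes hit = hit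
... | no  miss = ⊥-elim (<-irrefl refl (injective⇒≤ g-missing-y-injective))
  where
  g≢y : ∀ x → y ≢ g x
  g≢y x e = miss (x , sym e)
  -- g, viewed as a map into the complement of y, is still injective.
  g-missing-y : Fin (suc n) → Fin n
  g-missing-y x = punchOut (g≢y x)
  g-missing-y-injective : ∀ {x x'} → g-missing-y x ≡ g-missing-y x' → x ≡ x'
  g-missing-y-injective {x} {x'} e = injective x x' (punchOut-injective (g≢y x) (g≢y x') e)

factor-through-image : (f : Fin n → Fin n) (C : Fin n → Bool) → count C ≡ k →
  (∀ p → C (f p) ≡ true) → (∀ q → C q ≡ true → ∃ λ p → f p ≡ q) →
  ∃ λ (c : Fin n → Fin k) → IsSurjective c × (∀ p q → (f p ≡ f q) ⇔ (c p ≡ c q))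
factor-through-image f C size into onto = c , surjective , λ p q → mk⇔ (same-index p q) (same-image p q)
  where
  open Enumeration (enumerate-sized C size)
  c : Fin _ → Fin _
  c p = index (f p) (into p)
  index-cong : ∀ {v w} → v ≡ w → .(Cv : C v ≡ true) .(Cw : C w ≡ true) → index v Cv ≡ index w Cw
  index-cong refl _ _ = refl
  same-index : ∀ p q → f p ≡ f q → c p ≡ c q
  same-index p q fp≡fq = index-cong fp≡fq (into p) (into q)
  same-image : ∀ p q → c p ≡ c q → f p ≡ f q
  same-image p q cp≡cq = begin
    f p                   ≡⟨ element-index (f p) (into p) ⟨
    element (c p)         ≡⟨ cong element cp≡cq ⟩
    element (c q)         ≡⟨ element-index (f q) (into q) ⟩
    f q                   ∎
    where open ≡-Reasoning
  surjective : IsSurjective c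
  surjective i = let p , fp≡ei = onto (element i) (element-in i)
                 in p , trans (index-cong fp≡ei (into p) (element-in i)) (index-element i (element-in i))

-- 2α > t + 1 forces α > 0, which provides transversals.
double-bound⇒positive : ∀ {a b} → b < a + a → 0 < a
double-bound⇒positive {suc a} _ = s≤s z≤n

module EndomorphismOfPartialGeometry
  {n m s t α : ℕ} {inc : Fin n → Fin m → Bool}
  (PG : IsPartialGeometry n m s t α inc)
  (cliques-are-lines : ∀ (C : Fin n → Bool) → IsClique (Adj inc) (suc s) C →
                       ∃ λ (l : Fin m) → ∀ (p : Fin n) → C p ≡ inc p l)
  {f : Fin n → Fin n} (endo : IsEndomorphism (Adj inc) f) where

  open IsPartialGeometry PG

  pointsOf : Fin m → Fin n → Bool
  pointsOf ℓ p = inc p ℓ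

  linesThrough : Fin n → Fin m → Bool
  linesThrough p ℓ = inc p ℓ

  line-clique : ∀ ℓ → IsClique (Adj inc) (suc s) (pointsOf ℓ)
  line-clique ℓ = line-size ℓ , λ p q pℓ qℓ p≢q → p≢q , ℓ , pℓ , qℓ

  -- meeting p ℓ ℓ': the line ℓ' passes through p and meets ℓ.  For p off ℓ
  -- the α-axiom says there are exactly α such lines ℓ'.
  meeting : Fin n → Fin m → Fin m → Bool
  meeting p ℓ ℓ' = inc p ℓ' ∧ anyB (λ q → inc q ℓ' ∧ inc q ℓ)

  meeting-elim : ∀ {p ℓ ℓ'} → meeting p ℓ ℓ' ≡ true →
                 inc p ℓ' ≡ true × ∃ λ w → inc w ℓ' ≡ true × inc w ℓ ≡ true
  meeting-elim hit = let pℓ' , meets = ∧-split hit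
                         w , wℓ'∧wℓ = anyB-witness _ meets
                     in pℓ' , w , ∧-split wℓ'∧wℓ

  transversal : 0 < α → ∀ {v ℓ} → inc v ℓ ≡ false →
                ∃ λ ℓ' → inc v ℓ' ≡ true × ∃ λ w → inc w ℓ' ≡ true × inc w ℓ ≡ true
  transversal α>0 {v} {ℓ} vℓ =
    let ℓ' , hit = count-witness (meeting v ℓ) (subst (0 <_) (sym (alpha-axiom v ℓ vℓ)) α>0)
    in ℓ' , meeting-elim hit

  image-distinct : ∀ {p q} → Adj inc p q → f p ≢ f q
  image-distinct {p} {q} adj = proj₁ (endo p q adj)

  -- f is injective on each line, so a line is mapped onto an (s+1)-clique ...
  line-image-clique : ∀ ℓ → IsClique (Adj inc) (suc s) (image (pointsOf ℓ) f)
  line-image-clique ℓ = trans (image-count (pointsOf ℓ) f injective-on-ℓ) (line-size ℓ) , adjacent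
    where
    injective-on-ℓ : ∀ u u' → inc u ℓ ≡ true → inc u' ℓ ≡ true → f u ≡ f u' → u ≡ u'
    injective-on-ℓ u u' uℓ u'ℓ fu≡fu' with u ≟ u'
    ... | yes u≡u' = u≡u'
    ... | no  u≢u' = ⊥-elim (image-distinct (u≢u' , ℓ , uℓ , u'ℓ) fu≡fu')
    adjacent : ∀ p q → image (pointsOf ℓ) f p ≡ true → image (pointsOf ℓ) f q ≡ true → p ≢ q → Adj inc p q
    adjacent p q p∈ q∈ p≢q with image-elim (pointsOf ℓ) f p p∈ | image-elim (pointsOf ℓ) f q q∈
    ... | u , uℓ , refl | u' , u'ℓ , refl = endo u u' (p≢q ∘ cong f , ℓ , uℓ , u'ℓ)

  -- ... which by hypothesis is a line, the image line of ℓ.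
  lineImage : Fin m → Fin m
  lineImage ℓ = proj₁ (cliques-are-lines _ (line-image-clique ℓ))

  lineImage-on : ∀ {u ℓ} → inc u ℓ ≡ true → inc (f u) (lineImage ℓ) ≡ true
  lineImage-on {u} {ℓ} uℓ =
    trans (sym (proj₂ (cliques-are-lines _ (line-image-clique ℓ)) (f u))) (image-intro (pointsOf ℓ) f u uℓ)

  lineImage-onto : ∀ {v ℓ} → inc v (lineImage ℓ) ≡ true → ∃ λ u → inc u ℓ ≡ true × f u ≡ v
  lineImage-onto {v} {ℓ} vℓ =
    image-elim (pointsOf ℓ) f v (trans (proj₂ (cliques-are-lines _ (line-image-clique ℓ)) v) vℓ)

  -- An injective endomorphism is an automorphism: it permutes the points, it
  -- permutes the lines (a line has at least two points, so lineImage is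
  -- injective), and hence it also reflects collinearity.
  injective⇒automorphism : 0 < s → (∀ x y → f x ≡ f y → x ≡ y) → IsAutomorphism (Adj inc) f
  injective⇒automorphism s>0 injective =
    injective , injective⇒surjective f injective , λ p q → mk⇔ (endo p q) (reflects p q)
    where
    lineImage-injective : ∀ ℓ ℓ' → lineImage ℓ ≡ lineImage ℓ' → ℓ ≡ ℓ'
    lineImage-injective ℓ ℓ' same =
      let a , aℓ = count-witness (pointsOf ℓ) (subst (0 <_) (sym (line-size ℓ)) (s≤s z≤n))
          b , b≢a , bℓ = count-other-witness (pointsOf ℓ) (subst (1 <_) (sym (line-size ℓ)) (s≤s s>0)) a
      in points-joined-once a b ℓ ℓ' (b≢a ∘ sym) aℓ bℓ (on-ℓ' aℓ) (on-ℓ' bℓ)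
      where
      on-ℓ' : ∀ {z} → inc z ℓ ≡ true → inc z ℓ' ≡ true
      on-ℓ' {z} zℓ with lineImage-onto {ℓ = ℓ'} (subst (λ l → inc (f z) l ≡ true) same (lineImage-on zℓ))
      ... | u , uℓ' , fu≡fz rewrite injective u z fu≡fz = uℓ'
    reflects : ∀ p q → Adj inc (f p) (f q) → Adj inc p q
    reflects p q (fp≢fq , l , fpl , fql)
      with injective⇒surjective lineImage (lineImage-injective) l
    ... | ℓ , refl with lineImage-onto {ℓ = ℓ} fpl | lineImage-onto {ℓ = ℓ} fql
    ... | u , uℓ , fu≡fp | u' , u'ℓ , fu'≡fq
      rewrite injective u p fu≡fp | injective u' q fu'≡fq = fp≢fq ∘ cong f , ℓ , uℓ , u'ℓ

  Collapses : Fin n → Set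
  Collapses x = ∃ λ y → y ≢ x × f y ≡ f x

  collapses? : Dec (∃ Collapses)
  collapses? = any? λ x → any? λ y → ¬? (y ≟ x) ×-dec (f y ≟ f x)

  no-collapse⇒injective : ¬ ∃ Collapses → ∀ x y → f x ≡ f y → x ≡ y
  no-collapse⇒injective none x y fx≡fy with x ≟ y
  ... | yes x≡y = x≡y
  ... | no  x≢y = ⊥-elim (none (y , x , x≢y , fx≡fy))

  -- Then f x and f w are distinct points on both
  -- image lines, so ℓ and ℓ' have the same image line.
  transversal-image : ∀ {x y w ℓ ℓ'} → y ≢ x → f y ≡ f x → inc x ℓ ≡ true →
                      inc y ℓ' ≡ true → inc w ℓ' ≡ true → inc w ℓ ≡ true →
                      lineImage ℓ' ≡ lineImage ℓ
  transversal-image {x} {y} {w} {ℓ} {ℓ'} y≢x fy≡fx xℓ yℓ' wℓ' wℓ =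
    points-joined-once (f w) (f x) (lineImage ℓ') (lineImage ℓ)
      (image-distinct (w≢x , ℓ , wℓ , xℓ))
      (lineImage-on wℓ') (subst (λ z → inc z (lineImage ℓ') ≡ true) fy≡fx (lineImage-on yℓ'))
      (lineImage-on wℓ) (lineImage-on xℓ)
    where
    w≢x : w ≢ x
    w≢x refl = image-distinct (y≢x ∘ sym , ℓ' , wℓ' , yℓ') (sym fy≡fx)

  module Collapsing (α-large : suc t < α + α) where

    -- All lines through a collapsing point x have the same image line: the
    -- point y identified with x is on no line through x, and the α lines
    -- through y meeting ℓ and the α meeting ℓ' cannot be disjoint among the
    -- t + 1 lines through y.
    collapsed-lines-agree : ∀ {x ℓ ℓ'} → Collapses x → inc x ℓ ≡ true → inc x ℓ' ≡ true →
                            lineImage ℓ ≡ lineImage ℓ'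
    collapsed-lines-agree {x} {ℓ} {ℓ'} (y , y≢x , fy≡fx) xℓ xℓ' =
      let l , hit , hit' = common-element (meeting y ℓ) (meeting y ℓ') (linesThrough y)
                             (λ _ → proj₁ ∘ meeting-elim) (λ _ → proj₁ ∘ meeting-elim) enough
          yl , w , wl , wℓ = meeting-elim hit
          _ , w' , w'l , w'ℓ' = meeting-elim hit'
      in trans (sym (transversal-image y≢x fy≡fx xℓ yl wl wℓ))
               (transversal-image y≢x fy≡fx xℓ' yl w'l w'ℓ')
      where
      off : ∀ {l} → inc x l ≡ true → inc y l ≡ false
      off {l} xl with inc y l in yl
      ... | false = refl
      ... | true  = ⊥-elim (image-distinct (y≢x ∘ sym , l , xl , yl) (sym fy≡fx))
      enough : count (linesThrough y) < count (meeting y ℓ) + count (meeting y ℓ')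
      enough = subst₂ _<_ (sym (point-degree y))
                 (sym (cong₂ _+_ (alpha-axiom y ℓ (off xℓ)) (alpha-axiom y ℓ' (off xℓ')))) α-large

    neighbour-image : ∀ {x w ℓ} → Collapses x → inc x ℓ ≡ true → Adj inc x w →
                      inc (f w) (lineImage ℓ) ≡ true
    neighbour-image collapse xℓ (_ , ℓ' , xℓ' , wℓ') =
      subst (λ l → inc _ l ≡ true) (collapsed-lines-agree collapse xℓ' xℓ) (lineImage-on wℓ')

    -- With a second line ℓ' through x (t > 0), the image of a neighbour w
    -- on ℓ is also the image of a point of ℓ', which differs from w.
    collapse-spreads : 0 < t → ∀ {x w} → Collapses x → Adj inc x w → Collapses w
    collapse-spreads t>0 {x} {w} collapse adj@(x≢w , ℓ , xℓ , wℓ) =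
      let ℓ' , ℓ'≢ℓ , xℓ' = count-other-witness (linesThrough x)
                              (subst (1 <_) (sym (point-degree x)) (s≤s t>0)) ℓ
          u , uℓ' , fu≡fw = lineImage-onto (neighbour-image collapse xℓ' adj)
          u≢w : u ≢ w
          u≢w u≡w = ℓ'≢ℓ (points-joined-once x w ℓ' ℓ x≢w xℓ' (subst (λ z → inc z ℓ' ≡ true) u≡w uℓ') xℓ wℓ)
      in u , u≢w , fu≡fw

    -- Hence f maps every point onto the image line of a line through a
    -- collapsing point: points off that line are joined to it by a transversal.
    image-on-line : 0 < t → ∀ {x ℓ} → Collapses x → inc x ℓ ≡ true → ∀ v → inc (f v) (lineImage ℓ) ≡ true
    image-on-line t>0 {x} {ℓ} collapse xℓ v with inc v ℓ in vℓ
    ... | true  = lineImage-on vℓ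
    ... | false with transversal (double-bound⇒positive α-large) vℓ
    ... | ℓ' , vℓ' , w , wℓ' , wℓ = neighbour-image w-collapses wℓ (w≢v , ℓ' , wℓ' , vℓ')
      where
      w≢v : w ≢ v
      w≢v refl = true≢false (trans (sym wℓ) vℓ)
      w-collapses : Collapses w
      w-collapses with w ≟ x
      ... | yes refl = collapse
      ... | no  w≢x  = collapse-spreads t>0 collapse (w≢x ∘ sym , ℓ , xℓ , wℓ)

  proper-endomorphism-image-is-line : 0 < s → 0 < t → suc t < α + α → ¬ IsAutomorphism (Adj inc) f →
    ∃ λ L → (∀ v → inc (f v) L ≡ true) × (∀ q → inc q L ≡ true → ∃ λ p → f p ≡ q)
  proper-endomorphism-image-is-line s>0 t>0 α-large not-automorphism with collapses?
  ... | no  none = ⊥-elim (not-automorphism (injective⇒automorphism s>0 (no-collapse⇒injective none)))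
  ... | yes (x , collapse) =
    let ℓ , xℓ = count-witness (linesThrough x) (subst (0 <_) (sym (point-degree x)) (s≤s z≤n))
    in lineImage ℓ , image-on-line t>0 collapse xℓ , λ q qL → let u , _ , fu≡q = lineImage-onto qL in u , fu≡q
    where open Collapsing α-large

mainTheorem1 : ∀ (n m s t α : ℕ) (inc : Fin n → Fin m → Bool) →
    IsPartialGeometry n m s t α inc →
    1 < s → 1 < t → suc t < 2 * α →
    (∀ (C : Fin n → Bool) → IsClique (Adj inc) (suc s) C →
      ∃ λ (l : Fin m) → ∀ (p : Fin n) → C p ≡ inc p l) →
    ∀ (f : Fin n → Fin n) → IsProperEndomorphism (Adj inc) f →
      (∃ λ (C : Fin n → Bool) → IsClique (Adj inc) (suc s) C × IsImage f C) ×
      (∃ λ (c : Fin n → Fin (suc s)) →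
         IsHomToComplete (Adj inc) c × IsSurjective c ×
         (∀ (p q : Fin n) → (f p ≡ f q) ⇔ (c p ≡ c q)))
mainTheorem1 n m s t α inc PG s>1 t>1 t+1<2α cliques-are-lines f (endo , not-automorphism) =
  let α-large = subst (suc t <_) (cong (α +_) (+-identityʳ α)) t+1<2α
      L , into , onto = proper-endomorphism-image-is-line (<⇒≤ s>1) (<⇒≤ t>1) α-large not-automorphism
      c , c-surjective , same-fibres = factor-through-image f (pointsOf L) (line-size L) into onto
      colouring : IsHomToComplete (Adj inc) c
      colouring p q adj = image-distinct adj ∘ Equivalence.from (same-fibres p q)
  in (pointsOf L , line-clique L , λ q → mk⇔ (onto q) λ { (p , refl) → into p }) ,
     (c , colouring , c-surjective , same-fibres)
  where
  open IsPartialGeometry PG using (line-size)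
  open EndomorphismOfPartialGeometry PG cliques-are-lines endo
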